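{- For every $n\ge1$, \[ n-\frac32\log_2n-\frac32\le g(K_n^+,2)\le n-\log_2(n+2)+1. \]
   Context: $K_n^+$ is the signed digraph on $[n]=\{0,\dots,n-1\}$ without loops having an arc $(j,i)$ for every ordered pair $j\ne i$, each signed $+1$. $F(K_n^+,2)$ is the set of maps $f:\{0,1\}^n\to\{0,1\}^n$ such that each $f_i$ does not depend on $x_i$ and is non-decreasing in every other coordinate. $g(K_n^+,2)=\max_{f\in F(K_n^+,2)}\log_2|\mathrm{Fix}(f)|$, with $\mathrm{Fix}(f)$ the set of fixed points of $f$. -}

module Defs where

open import Data.Nat using (ℕ; zero; suc)
open import Data.Bool using (Bool; true; false; _≤_) renaming (_≟_ to _≟B_)
open import Data.Fin using (Fin)
open import Data.Vec using (Vec; []; _∷_; lookup; _[_]≔_)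
open import Data.Vec.Properties using (≡-dec)
open import Data.List using (List; [_]; _++_; map; filter; length)
open import Data.Product using (_×_)
open import Relation.Binary.PropositionalEquality using (_≡_; _≢_)

-- A configuration x ∈ {0,1}^n (false = 0, true = 1); coordinate i is lookup x i.
Config : ℕ → Set
Config n = Vec Bool n

IndepOfSelf : (n : ℕ) → (Config n → Config n) → Set
IndepOfSelf n f = ∀ (i : Fin n) (x y : Config n) →
  (∀ (j : Fin n) → j ≢ i → lookup x j ≡ lookup y j) →
  lookup (f x) i ≡ lookup (f y) i

MonotoneInOthers : (n : ℕ) → (Config n → Config n) → Set
MonotoneInOthers n f = ∀ (i j : Fin n) → j ≢ i → (x : Config n) →
  lookup (f (x [ j ]≔ false)) i ≤ lookup (f (x [ j ]≔ true)) i

InF : (n : ℕ) → (Config n → Config n) → Set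
InF n f = IndepOfSelf n f × MonotoneInOthers n f

allConfigs : (n : ℕ) → List (Config n)
allConfigs zero = [ [] ]
allConfigs (suc n) = map (false ∷_) (allConfigs n) ++ map (true ∷_) (allConfigs n)

numFix : (n : ℕ) → (Config n → Config n) → ℕ
numFix n f = length (filter (λ x → ≡-dec _≟B_ (f x) x) (allConfigs n))

module Submission where

-- Proposition 5: for n ≥ 1,  n - (3/2)log₂ n - 3/2 ≤ g(K_n^+, 2) ≤ n - log₂(n + 2) + 1,
-- stated in exponential form: some f ∈ F(K_n^+,2) has 4^n ≤ 8n³·|Fix f|², and every
-- f ∈ F(K_n^+,2) has |Fix f|·(n + 2) ≤ 2^(n+1).
--
-- Call x and x ⊕ eᵢ neighbours.  (i) Fixed points are isolated: f_i ignores
-- x_i, so a fixed y and a fixed y ⊕ eᵢ would give y_i = f_i(y) = f_i(y ⊕ eᵢ) = ¬y_i.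
-- (ii) Any y has at most one fixed neighbour y ⊕ eᵢ with y_i = 1 and at most one with
-- y_i = 0: two of them, across i ≠ k, make x_k ↦ f_i(y[k := x_k]) the negation, which is
-- not monotone.  Summing "fixed neighbours of y + 2·[y fixed] ≤ 2" over the cube counts
-- every fixed point n + 2 times.
--
-- Let A be the set of x with |x| = k and Σ_{x_j = 1} j ≡ a (mod n).  An
-- explicit monotone self-independent f fixes every point of A; by pigeonhole over the
-- residue a some A has at least C(n,k)/n points, and 4^n ≤ 8n·C(n,k)² for k = ⌈n/2⌉.

open import Defs
open import Data.Nat using (ℕ; zero; suc; _+_; _*_; _^_; _≤_; _<_; _∸_; _%_; _/_; z≤n; s≤s; NonZero) renaming (_≟_ to _≟ℕ_)
open import Data.Nat.Properties
open import Data.Nat.DivMod using (m≡m%n+[m/n]*n; [m+kn]%n≡m%n; m<n⇒m%n≡m; m%n<n; m%n%n≡m%n; %-distribˡ-+)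
open import Data.Nat.Combinatorics using (_C_; nCk+nC[k+1]≡[n+1]C[k+1]; nCk≡nC[n∸k]; nC1≡n)
open import Data.Nat.Tactic.RingSolver using (solve-∀)
open import Data.Bool using (Bool; true; false; not; if_then_else_; b≤b; f≤t) renaming (_≤_ to _≤𝔹_; _≟_ to _≟𝔹_)
open import Data.Bool.Properties using (not-¬)
open import Data.Fin using (Fin; zero; suc; toℕ) renaming (_≟_ to _≟F_)
open import Data.Fin.Properties using (toℕ-injective; toℕ<n; any?) renaming (suc-injective to Fin-suc-injective; 0≢1+n to Fin-0≢1+n)
open import Data.Vec using (Vec; []; _∷_; lookup; _[_]≔_; tabulate)
open import Data.Vec.Properties using (≡-dec; lookup∘update; lookup∘update′; []≔-lookup; []≔-commutes; []≔-idempotent; lookup∘tabulate; tabulate∘lookup; tabulate-cong)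
open import Data.List using (List; []; _∷_; _++_; map; filter; length)
open import Data.List.Properties using (filter-++; length-++)
open import Data.Product using (Σ; _×_; _,_; ∃)
open import Data.Sum using (_⊎_; inj₁; inj₂)
open import Data.Empty using (⊥; ⊥-elim)
open import Relation.Nullary using (Dec; yes; no; does; ¬_; contradiction)
open import Relation.Nullary.Decidable using (_⊎-dec_; _×-dec_)
open import Relation.Unary using (Pred; Decidable)
open import Relation.Binary.PropositionalEquality
open import Function using (_∘_)
open import Level using (0ℓ)
open import Algebra.Properties.Semiring.Sum +-*-semiring using (sum; sum-cong-≗; sum-replicate-zero; ∑-distrib-+; *-distribˡ-sum)
open import Algebra.Properties.CommutativeSemigroup +-commutativeSemigroup using (interchange; xy∙z≈xz∙y)

sum-mono : ∀ {n} {d e : Fin n → ℕ} → (∀ i → d i ≤ e i) → sum d ≤ sum e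
sum-mono {zero} _ = z≤n
sum-mono {suc n} d≤e = +-mono-≤ (d≤e zero) (sum-mono (d≤e ∘ suc))

sum-const : ∀ n c → sum {n} (λ _ → c) ≡ n * c
sum-const zero c = refl
sum-const (suc n) c = cong (c +_) (sum-const n c)

sum-≤1 : ∀ {n} (d : Fin n → ℕ) → (∀ i → d i ≤ 1) → (∀ i j → 1 ≤ d i → 1 ≤ d j → i ≡ j) → sum d ≤ 1
sum-≤1 {zero} _ _ _ = z≤n
sum-≤1 {suc n} d d≤1 unique with 1 ≤? d zero
... | no d₀≱1 = subst (λ m → m + sum (d ∘ suc) ≤ 1) (sym (n<1⇒n≡0 (≰⇒> d₀≱1)))
                  (sum-≤1 (d ∘ suc) (d≤1 ∘ suc) (λ i j p q → Fin-suc-injective (unique _ _ p q)))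
... | yes d₀≥1 = subst (λ s → d zero + s ≤ 1) (sym rest≡0) (subst (_≤ 1) (sym (+-identityʳ (d zero))) (d≤1 zero))
  where
  rest≡0 : sum (d ∘ suc) ≡ 0
  rest≡0 = trans (sum-cong-≗ (λ i → n<1⇒n≡0 (≰⇒> (λ dᵢ≥1 → Fin-0≢1+n (unique zero (suc i) d₀≥1 dᵢ≥1))))) (sum-replicate-zero n)

argmax : ∀ n (e : Fin (suc n) → ℕ) → ∃ λ a → ∀ b → e b ≤ e a
argmax zero e = zero , λ { zero → ≤-refl }
argmax (suc n) e with argmax n (e ∘ suc)
... | a , max with e zero ≤? e (suc a)
...   | yes e₀≤ = suc a , λ { zero → e₀≤ ; (suc b) → max b }
...   | no e₀≰ = zero , λ { zero → ≤-refl ; (suc b) → ≤-trans (max b) (<⇒≤ (≰⇒> e₀≰)) }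

pigeonhole : ∀ n (e : Fin (suc n) → ℕ) → ∃ λ a → sum e ≤ suc n * e a
pigeonhole n e with argmax n e
... | a , max = a , ≤-trans (sum-mono max) (≤-reflexive (sum-const (suc n) (e a)))

𝟙 : ∀ {p} {P : Set p} → Dec P → ℕ
𝟙 d = if does d then 1 else 0

𝟙≤1 : ∀ {p} {P : Set p} (d : Dec P) → 𝟙 d ≤ 1
𝟙≤1 (yes _) = ≤-refl
𝟙≤1 (no _) = z≤n

𝟙-sound : ∀ {p} {P : Set p} (d : Dec P) → 1 ≤ 𝟙 d → P
𝟙-sound (yes p) _ = p
𝟙-sound (no _) ()

does-yes : ∀ {p} {P : Set p} (d : Dec P) → P → does d ≡ true
does-yes (yes _) _ = refl
does-yes (no ¬p) p = contradiction p ¬p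

does-no : ∀ {p} {P : Set p} (d : Dec P) → ¬ P → does d ≡ false
does-no (yes p) ¬p = contradiction p ¬p
does-no (no _) _ = refl

𝟙-complete : ∀ {p} {P : Set p} (d : Dec P) → P → 𝟙 d ≡ 1
𝟙-complete d p = cong (if_then 1 else 0) (does-yes d p)

𝟙-reject : ∀ {p} {P : Set p} (d : Dec P) → ¬ P → 𝟙 d ≡ 0
𝟙-reject d ¬p = cong (if_then 1 else 0) (does-no d ¬p)

𝟙*𝟙≤𝟙 : ∀ {P Q R : Set} (p : Dec P) (q : Dec Q) (r : Dec R) → (P → Q → R) → 𝟙 p * 𝟙 q ≤ 𝟙 r
𝟙*𝟙≤𝟙 (yes p) (yes q) r pq⇒r = ≤-reflexive (sym (𝟙-complete r (pq⇒r p q)))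
𝟙*𝟙≤𝟙 (yes _) (no _) _ _ = z≤n
𝟙*𝟙≤𝟙 (no _) _ _ _ = z≤n

does-mono : ∀ {P Q : Set} (p : Dec P) (q : Dec Q) → (P → Q) → does p ≤𝔹 does q
does-mono (yes _) (yes _) _ = b≤b
does-mono (yes p) (no ¬q) p⇒q = contradiction (p⇒q p) ¬q
does-mono (no _) (yes _) _ = f≤t
does-mono (no _) (no _) _ = b≤b

cubeSum : (n : ℕ) → (Config n → ℕ) → ℕ
cubeSum zero g = g []
cubeSum (suc n) g = cubeSum n (λ x → g (false ∷ x)) + cubeSum n (λ x → g (true ∷ x))

cubeSum-cong : ∀ n {g h : Config n → ℕ} → (∀ x → g x ≡ h x) → cubeSum n g ≡ cubeSum n h
cubeSum-cong zero g≡h = g≡h []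
cubeSum-cong (suc n) g≡h = cong₂ _+_ (cubeSum-cong n (g≡h ∘ (false ∷_))) (cubeSum-cong n (g≡h ∘ (true ∷_)))

cubeSum-mono : ∀ n {g h : Config n → ℕ} → (∀ x → g x ≤ h x) → cubeSum n g ≤ cubeSum n h
cubeSum-mono zero g≤h = g≤h []
cubeSum-mono (suc n) g≤h = +-mono-≤ (cubeSum-mono n (g≤h ∘ (false ∷_))) (cubeSum-mono n (g≤h ∘ (true ∷_)))

cubeSum-+ : ∀ n (g h : Config n → ℕ) → cubeSum n (λ x → g x + h x) ≡ cubeSum n g + cubeSum n h
cubeSum-+ zero g h = refl
cubeSum-+ (suc n) g h =
  trans (cong₂ _+_ (cubeSum-+ n (g ∘ (false ∷_)) (h ∘ (false ∷_))) (cubeSum-+ n (g ∘ (true ∷_)) (h ∘ (true ∷_))))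
    (interchange (cubeSum n (g ∘ (false ∷_))) (cubeSum n (h ∘ (false ∷_))) (cubeSum n (g ∘ (true ∷_))) _)

cubeSum-scale : ∀ n c (g : Config n → ℕ) → cubeSum n (λ x → c * g x) ≡ c * cubeSum n g
cubeSum-scale zero c g = refl
cubeSum-scale (suc n) c g = trans (cong₂ _+_ (cubeSum-scale n c (g ∘ (false ∷_))) (cubeSum-scale n c (g ∘ (true ∷_)))) (sym (*-distribˡ-+ c _ _))

cubeSum-const : ∀ n c → cubeSum n (λ _ → c) ≡ c * 2 ^ n
cubeSum-const zero c = sym (*-identityʳ c)
cubeSum-const (suc n) c = trans (cong₂ _+_ (cubeSum-const n c) (cubeSum-const n c)) (double c (2 ^ n))
  where
  double : ∀ a b → a * b + a * b ≡ a * (2 * b)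
  double = solve-∀

flip : ∀ {n} → Fin n → Config n → Config n
flip i x = x [ i ]≔ not (lookup x i)

-- flip i is a bijection of the cube, so it does not change cube sums.
cubeSum-flip : ∀ n (i : Fin n) (g : Config n → ℕ) → cubeSum n (λ x → g (flip i x)) ≡ cubeSum n g
cubeSum-flip (suc n) zero g = +-comm (cubeSum n (λ x → g (true ∷ x))) _
cubeSum-flip (suc n) (suc i) g = cong₂ _+_ (cubeSum-flip n i (g ∘ (false ∷_))) (cubeSum-flip n i (g ∘ (true ∷_)))

cubeSum-sum : ∀ n {m} (h : Fin m → Config n → ℕ) → cubeSum n (λ x → sum (λ i → h i x)) ≡ sum (λ i → cubeSum n (h i))
cubeSum-sum n {zero} h = cubeSum-const n 0
cubeSum-sum n {suc m} h = trans (cubeSum-+ n (h zero) _) (cong (cubeSum n (h zero) +_) (cubeSum-sum n (h ∘ suc)))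

length-filter-map : ∀ {A B : Set} {P : Pred B 0ℓ} (P? : Decidable P) (g : A → B) (xs : List A) →
  length (filter P? (map g xs)) ≡ length (filter (P? ∘ g) xs)
length-filter-map P? g [] = refl
length-filter-map P? g (x ∷ xs) with does (P? (g x))
... | false = length-filter-map P? g xs
... | true = cong suc (length-filter-map P? g xs)

count≡cubeSum : ∀ n {P : Pred (Config n) 0ℓ} (P? : Decidable P) → length (filter P? (allConfigs n)) ≡ cubeSum n (𝟙 ∘ P?)
count≡cubeSum zero P? with does (P? [])
... | false = refl
... | true = refl
count≡cubeSum (suc n) P? = begin
  length (filter P? (map (false ∷_) xs ++ map (true ∷_) xs))
    ≡⟨ cong length (filter-++ P? (map (false ∷_) xs) _) ⟩
  length (filter P? (map (false ∷_) xs) ++ filter P? (map (true ∷_) xs))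
    ≡⟨ length-++ (filter P? (map (false ∷_) xs)) ⟩
  length (filter P? (map (false ∷_) xs)) + length (filter P? (map (true ∷_) xs))
    ≡⟨ cong₂ _+_ (length-filter-map P? (false ∷_) xs) (length-filter-map P? (true ∷_) xs) ⟩
  length (filter (P? ∘ (false ∷_)) xs) + length (filter (P? ∘ (true ∷_)) xs)
    ≡⟨ cong₂ _+_ (count≡cubeSum n (P? ∘ (false ∷_))) (count≡cubeSum n (P? ∘ (true ∷_))) ⟩
  cubeSum (suc n) (𝟙 ∘ P?) ∎
  where
  open ≡-Reasoning
  xs = allConfigs n

isFix : ∀ {n} → (Config n → Config n) → Config n → ℕ
isFix f x = 𝟙 (≡-dec _≟𝔹_ (f x) x)

numFix≡cubeSum : ∀ n (f : Config n → Config n) → numFix n f ≡ cubeSum n (isFix f)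
numFix≡cubeSum n f = count≡cubeSum n (λ x → ≡-dec _≟𝔹_ (f x) x)

lookup-ext : ∀ {A : Set} {n} (x y : Vec A n) → (∀ i → lookup x i ≡ lookup y i) → x ≡ y
lookup-ext x y x≗y = trans (sym (tabulate∘lookup x)) (trans (tabulate-cong x≗y) (tabulate∘lookup y))

update-agree : ∀ {A : Set} {n} (x y : Vec A n) i b → (∀ j → j ≢ i → lookup x j ≡ lookup y j) → x [ i ]≔ b ≡ y [ i ]≔ b
update-agree x y i b agree = lookup-ext _ _ same
  where
  same : ∀ j → lookup (x [ i ]≔ b) j ≡ lookup (y [ i ]≔ b) j
  same j with j ≟F i
  ... | yes refl = trans (lookup∘update j x b) (sym (lookup∘update j y b))
  ... | no j≢i = trans (lookup∘update′ j≢i x b) (trans (agree j j≢i) (sym (lookup∘update′ j≢i y b)))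

true≰false : ¬ (true ≤𝔹 false)
true≰false ()

monotone-not-negation : ∀ (g : Bool → Bool) b → g b ≡ not b → g (not b) ≡ b → ¬ (g false ≤𝔹 g true)
monotone-not-negation g false g-false g-true le = true≰false (subst₂ _≤𝔹_ g-false g-true le)
monotone-not-negation g true g-true g-false le = true≰false (subst₂ _≤𝔹_ g-false g-true le)

module UpperBound {n : ℕ} (f : Config n → Config n) (indep : IndepOfSelf n f) (mono : MonotoneInOthers n f) where

  Fixed : Config n → Set
  Fixed x = f x ≡ x

  f-flip-same : ∀ i y → lookup (f (flip i y)) i ≡ lookup (f y) i
  f-flip-same i y = indep i (flip i y) y (λ j j≢i → lookup∘update′ j≢i y _)

  flip-fixed-at : ∀ i y → Fixed (flip i y) → lookup (f y) i ≡ not (lookup y i)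
  flip-fixed-at i y fix = begin
    lookup (f y) i           ≡⟨ sym (f-flip-same i y) ⟩
    lookup (f (flip i y)) i  ≡⟨ cong (λ z → lookup z i) fix ⟩
    lookup (flip i y) i      ≡⟨ lookup∘update i y _ ⟩
    not (lookup y i)         ∎
    where open ≡-Reasoning

  flip-fixed-off : ∀ i k y → i ≢ k → Fixed (flip k y) → lookup (f (flip k y)) i ≡ lookup y i
  flip-fixed-off i k y i≢k fix = trans (cong (λ z → lookup z i) fix) (lookup∘update′ i≢k y _)

  fixed-isolated : ∀ i y → Fixed y → ¬ Fixed (flip i y)
  fixed-isolated i y fix fix′ = not-¬ refl (begin
    lookup y i        ≡⟨ cong (λ z → lookup z i) (sym fix) ⟩
    lookup (f y) i    ≡⟨ flip-fixed-at i y fix′ ⟩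
    not (lookup y i)  ∎)
    where open ≡-Reasoning

  -- (ii) y has no two fixed neighbours across coordinates i ≠ k on which it agrees:
  -- c ↦ f_i(y[k := c]) would be the negation, against monotonicity in x_k.
  fixed-neighbours-differ : ∀ y i k → i ≢ k → lookup y i ≡ lookup y k → Fixed (flip i y) → Fixed (flip k y) → ⊥
  fixed-neighbours-differ y i k i≢k yᵢ≡yₖ fixᵢ fixₖ =
    monotone-not-negation fᵢ (lookup y k) at-y at-flip (mono i k (i≢k ∘ sym) y)
    where
    open ≡-Reasoning
    fᵢ : Bool → Bool
    fᵢ c = lookup (f (y [ k ]≔ c)) i
    at-y : fᵢ (lookup y k) ≡ not (lookup y k)
    at-y = begin
      fᵢ (lookup y k)   ≡⟨ cong (λ z → lookup (f z) i) ([]≔-lookup y k) ⟩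
      lookup (f y) i    ≡⟨ flip-fixed-at i y fixᵢ ⟩
      not (lookup y i)  ≡⟨ cong not yᵢ≡yₖ ⟩
      not (lookup y k)  ∎
    at-flip : fᵢ (not (lookup y k)) ≡ lookup y k
    at-flip = trans (flip-fixed-off i k y i≢k fixₖ) yᵢ≡yₖ

  fixedNbrOn : Bool → Config n → Fin n → ℕ
  fixedNbrOn b y i = if does (lookup y i ≟𝔹 b) then isFix f (flip i y) else 0

  fixedNbrOn-split : ∀ y i → isFix f (flip i y) ≡ fixedNbrOn true y i + fixedNbrOn false y i
  fixedNbrOn-split y i = split (lookup y i) (isFix f (flip i y))
    where
    split : ∀ c m → m ≡ (if does (c ≟𝔹 true) then m else 0) + (if does (c ≟𝔹 false) then m else 0)
    split true m = sym (+-identityʳ m)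
    split false m = refl

  fixedNbrOn≤1 : ∀ b y i → fixedNbrOn b y i ≤ 1
  fixedNbrOn≤1 b y i with does (lookup y i ≟𝔹 b)
  ... | true = 𝟙≤1 (≡-dec _≟𝔹_ (f (flip i y)) (flip i y))
  ... | false = z≤n

  fixedNbrOn-sound : ∀ b y i → 1 ≤ fixedNbrOn b y i → lookup y i ≡ b × Fixed (flip i y)
  fixedNbrOn-sound b y i pos with lookup y i ≟𝔹 b
  ... | yes yᵢ≡b = yᵢ≡b , 𝟙-sound (≡-dec _≟𝔹_ (f (flip i y)) (flip i y)) pos
  ... | no _ = contradiction pos λ ()

  fixedNbrs-on-side : ∀ b y → sum (fixedNbrOn b y) ≤ 1
  fixedNbrs-on-side b y = sum-≤1 (fixedNbrOn b y) (fixedNbrOn≤1 b y) unique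
    where
    unique : ∀ i k → 1 ≤ fixedNbrOn b y i → 1 ≤ fixedNbrOn b y k → i ≡ k
    unique i k posᵢ posₖ with i ≟F k | fixedNbrOn-sound b y i posᵢ | fixedNbrOn-sound b y k posₖ
    ... | yes i≡k | _ | _ = i≡k
    ... | no i≢k | yᵢ≡b , fixᵢ | yₖ≡b , fixₖ = ⊥-elim (fixed-neighbours-differ y i k i≢k (trans yᵢ≡b (sym yₖ≡b)) fixᵢ fixₖ)

  -- Each y carries weight at most 2: a fixed y has no fixed neighbour, any other y has
  -- at most two.
  local-bound : ∀ y → sum (λ i → isFix f (flip i y)) + 2 * isFix f y ≤ 2
  local-bound y with ≡-dec _≟𝔹_ (f y) y
  ... | yes fix = ≤-reflexive (cong (_+ 2) (trans (sum-cong-≗ no-fixed-nbr) (sum-replicate-zero n)))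
    where
    no-fixed-nbr : ∀ i → isFix f (flip i y) ≡ 0
    no-fixed-nbr i = 𝟙-reject (≡-dec _≟𝔹_ (f (flip i y)) (flip i y)) (fixed-isolated i y fix)
  ... | no _ = begin
    sum (λ i → isFix f (flip i y)) + 0                   ≡⟨ +-identityʳ _ ⟩
    sum (λ i → isFix f (flip i y))                       ≡⟨ sum-cong-≗ (fixedNbrOn-split y) ⟩
    sum (λ i → fixedNbrOn true y i + fixedNbrOn false y i) ≡⟨ ∑-distrib-+ (fixedNbrOn true y) (fixedNbrOn false y) ⟩
    sum (fixedNbrOn true y) + sum (fixedNbrOn false y)   ≤⟨ +-mono-≤ (fixedNbrs-on-side true y) (fixedNbrs-on-side false y) ⟩
    2                                                    ∎
    where open ≤-Reasoning

  -- Double counting: summing the local bound over the cube counts each fixed point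
  -- n times as a neighbour and twice by itself.
  upper-bound : numFix n f * (n + 2) ≤ 2 ^ (n + 1)
  upper-bound = begin
    numFix n f * (n + 2)
      ≡⟨ cong (_* (n + 2)) (numFix≡cubeSum n f) ⟩
    F * (n + 2)
      ≡⟨ distrib F n ⟩
    n * F + 2 * F
      ≡⟨ cong (_+ 2 * F) (sym (sum-const n F)) ⟩
    sum {n} (λ _ → F) + 2 * F
      ≡⟨ cong₂ _+_ (sym (sum-cong-≗ {n} (λ i → cubeSum-flip n i (isFix f)))) (sym (cubeSum-scale n 2 (isFix f))) ⟩
    sum (λ i → cubeSum n (λ y → isFix f (flip i y))) + cubeSum n (λ y → 2 * isFix f y)
      ≡⟨ cong (_+ cubeSum n (λ y → 2 * isFix f y)) (sym (cubeSum-sum n (λ i y → isFix f (flip i y)))) ⟩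
    cubeSum n (λ y → sum (λ i → isFix f (flip i y))) + cubeSum n (λ y → 2 * isFix f y)
      ≡⟨ sym (cubeSum-+ n _ _) ⟩
    cubeSum n (λ y → sum (λ i → isFix f (flip i y)) + 2 * isFix f y)
      ≤⟨ cubeSum-mono n local-bound ⟩
    cubeSum n (λ _ → 2)
      ≡⟨ cubeSum-const n 2 ⟩
    2 * 2 ^ n
      ≡⟨ cong (2 ^_) (+-comm 1 n) ⟩
    2 ^ (n + 1) ∎
    where
    open ≤-Reasoning
    F = cubeSum n (isFix f)
    distrib : ∀ a m → a * (m + 2) ≡ m * a + 2 * a
    distrib = solve-∀

absorption : ∀ n k → suc k * (suc n C suc k) ≡ suc n * (n C k)
absorption zero zero = refl
absorption zero (suc k) = *-zeroʳ (suc (suc k))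
absorption (suc n) zero = trans (*-identityˡ _) (trans (nC1≡n (suc (suc n))) (sym (*-identityʳ (suc (suc n)))))
absorption (suc n) (suc k) = begin
  suc (suc k) * (suc (suc n) C suc (suc k))
    ≡⟨ cong (suc (suc k) *_) (sym (nCk+nC[k+1]≡[n+1]C[k+1] (suc n) (suc k))) ⟩
  suc (suc k) * (A + B)
    ≡⟨ expand (suc k) A B ⟩
  suc (suc k) * B + (suc k * A + A)
    ≡⟨ cong₂ (λ u v → u + (v + A)) (absorption n (suc k)) (absorption n k) ⟩
  suc n * (n C suc k) + (suc n * (n C k) + A)
    ≡⟨ collect (suc n) (n C suc k) (n C k) A ⟩
  suc n * (n C k + n C suc k) + A
    ≡⟨ cong (λ z → suc n * z + A) (nCk+nC[k+1]≡[n+1]C[k+1] n k) ⟩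
  suc n * A + A
    ≡⟨ +-comm (suc n * A) A ⟩
  suc (suc n) * A ∎
  where
  open ≡-Reasoning
  A = suc n C suc k
  B = suc n C suc (suc k)
  expand : ∀ j a b → suc j * (a + b) ≡ suc j * b + (j * a + a)
  expand = solve-∀
  collect : ∀ m u v a → m * u + (m * v + a) ≡ m * (v + u) + a
  collect = solve-∀

midC : ℕ → ℕ
midC m = suc (m + m) C suc m

-- C(2m+2, m+1) = 2·C(2m+1, m+1), by Pascal's rule and the symmetry C(2m+1, m) = C(2m+1, m+1).
midC-even : ∀ m → suc (suc (m + m)) C suc m ≡ 2 * midC m
midC-even m = begin
  suc (suc (m + m)) C suc m    ≡⟨ sym (nCk+nC[k+1]≡[n+1]C[k+1] (suc (m + m)) m) ⟩
  suc (m + m) C m + midC m     ≡⟨ cong (_+ midC m) symmetry ⟩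
  midC m + midC m              ≡⟨ cong (midC m +_) (sym (+-identityʳ (midC m))) ⟩
  2 * midC m                   ∎
  where
  open ≡-Reasoning
  symmetry : suc (m + m) C m ≡ midC m
  symmetry = trans (nCk≡nC[n∸k] (≤-trans (m≤m+n m m) (n≤1+n _)))
                   (cong (suc (m + m) C_) (trans (cong (_∸ m) (sym (+-suc m m))) (m+n∸m≡n m (suc m))))

midC-step : ∀ m → suc (suc m) * midC (suc m) ≡ suc (suc (suc (m + m))) * (2 * midC m)
midC-step m = begin
  suc (suc m) * midC (suc m)
    ≡⟨ cong (λ t → suc (suc m) * (suc (suc t) C suc (suc m))) (+-suc m m) ⟩
  suc (suc m) * (suc (suc (suc (m + m))) C suc (suc m))
    ≡⟨ absorption (suc (suc (m + m))) (suc m) ⟩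
  suc (suc (suc (m + m))) * (suc (suc (m + m)) C suc m)
    ≡⟨ cong (suc (suc (suc (m + m))) *_) (midC-even m) ⟩
  suc (suc (suc (m + m))) * (2 * midC m) ∎
  where open ≡-Reasoning

midC-bound : ∀ m → 16 ^ m ≤ suc m * (midC m * midC m)
midC-bound zero = s≤s z≤n
midC-bound (suc m) = *-cancelˡ-≤ (suc m * suc (suc m)) (begin
  suc m * suc (suc m) * 16 ^ suc m            ≡⟨ reorder m (16 ^ m) ⟩
  16 * (suc m * suc (suc m)) * 16 ^ m         ≤⟨ *-monoˡ-≤ (16 ^ m) (square-bound m) ⟩
  4 * (T * T) * 16 ^ m                        ≤⟨ *-monoʳ-≤ (4 * (T * T)) (midC-bound m) ⟩
  4 * (T * T) * (suc m * (D * D))             ≡⟨ regroup T (suc m) D ⟩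
  suc m * ((T * (2 * D)) * (T * (2 * D)))     ≡⟨ cong (λ z → suc m * (z * z)) (sym (midC-step m)) ⟩
  suc m * ((suc (suc m) * D′) * (suc (suc m) * D′)) ≡⟨ regroup′ (suc m) (suc (suc m)) D′ ⟩
  suc m * suc (suc m) * (suc (suc m) * (D′ * D′)) ∎)
  where
  open ≤-Reasoning
  D = midC m
  D′ = midC (suc m)
  T = suc (suc (suc (m + m)))
  reorder : ∀ m x → suc m * suc (suc m) * (16 * x) ≡ 16 * (suc m * suc (suc m)) * x
  reorder = solve-∀
  square-bound : ∀ m → 16 * (suc m * suc (suc m)) ≤ 4 * (suc (suc (suc (m + m))) * suc (suc (suc (m + m))))
  square-bound m = subst (16 * (suc m * suc (suc m)) ≤_) (sym (excess m)) (m≤m+n _ 4)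
    where
    excess : ∀ m → 4 * (suc (suc (suc (m + m))) * suc (suc (suc (m + m)))) ≡ 16 * (suc m * suc (suc m)) + 4
    excess = solve-∀
  regroup : ∀ t a x → 4 * (t * t) * (a * (x * x)) ≡ a * ((t * (2 * x)) * (t * (2 * x)))
  regroup = solve-∀
  regroup′ : ∀ a b y → a * ((b * y) * (b * y)) ≡ a * b * (b * (y * y))
  regroup′ = solve-∀

parity : ∀ n → ∃ λ m → n ≡ m + m ⊎ n ≡ suc (m + m)
parity zero = 0 , inj₁ refl
parity (suc n) with parity n
... | m , inj₁ n≡2m = m , inj₂ (cong suc n≡2m)
... | m , inj₂ n≡2m+1 = suc m , inj₁ (cong suc (trans n≡2m+1 (sym (+-suc m m))))

16^m≡4^[m+m] : ∀ m → 16 ^ m ≡ 4 ^ (m + m)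
16^m≡4^[m+m] m = trans (^-*-assoc 4 2 m) (cong (λ t → 4 ^ (m + t)) (+-identityʳ m))

binomial-bound : ∀ n → ∃ λ k → 4 ^ suc n ≤ 8 * suc n * ((suc n C k) * (suc n C k))
binomial-bound n with parity n
... | m , inj₁ refl = suc m , (begin
  4 * 4 ^ (m + m)                 ≡⟨ cong (4 *_) (sym (16^m≡4^[m+m] m)) ⟩
  4 * 16 ^ m                      ≤⟨ *-monoʳ-≤ 4 (midC-bound m) ⟩
  4 * (suc m * (D * D))           ≤⟨ slack m (D * D) ⟩
  8 * suc (m + m) * (D * D)       ∎)
  where
  open ≤-Reasoning
  D = midC m
  slack : ∀ m x → 4 * (suc m * x) ≤ 8 * suc (m + m) * x
  slack m x = subst (4 * (suc m * x) ≤_) (sym (excess m x)) (m≤m+n _ _)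
    where
    excess : ∀ m x → 8 * suc (m + m) * x ≡ 4 * (suc m * x) + (4 * x + 12 * (m * x))
    excess = solve-∀
... | m , inj₂ refl = suc m , (begin
  4 * (4 * 4 ^ (m + m))                             ≡⟨ cong (λ z → 4 * (4 * z)) (sym (16^m≡4^[m+m] m)) ⟩
  4 * (4 * 16 ^ m)                                  ≤⟨ *-monoʳ-≤ 4 (*-monoʳ-≤ 4 (midC-bound m)) ⟩
  4 * (4 * (suc m * (D * D)))                       ≤⟨ slack m D ⟩
  8 * suc (suc (m + m)) * ((2 * D) * (2 * D))        ≡⟨ cong (λ z → 8 * suc (suc (m + m)) * (z * z)) (sym (midC-even m)) ⟩
  8 * suc (suc (m + m)) * (E * E)                    ∎)
  where
  open ≤-Reasoning
  D = midC m
  E = suc (suc (m + m)) C suc m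
  slack : ∀ m x → 4 * (4 * (suc m * (x * x))) ≤ 8 * suc (suc (m + m)) * ((2 * x) * (2 * x))
  slack m x = subst (4 * (4 * (suc m * (x * x))) ≤_) (sym (excess m x)) (m≤m+n _ _)
    where
    excess : ∀ m x → 8 * suc (suc (m + m)) * ((2 * x) * (2 * x)) ≡ 4 * (4 * (suc m * (x * x))) + 48 * (suc m * (x * x))
    excess = solve-∀

weight : ∀ {m} → Config m → ℕ
weight [] = 0
weight (false ∷ x) = weight x
weight (true ∷ x) = suc (weight x)

-- The index sum Σ_{x_j = 1} j; prepending a coordinate shifts every index by one.
indexSum : ∀ {m} → Config m → ℕ
indexSum [] = 0
indexSum (_ ∷ x) = weight x + indexSum x

weight-raise : ∀ {m} (y : Config m) j → lookup y j ≡ false → weight (y [ j ]≔ true) ≡ suc (weight y)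
weight-raise (false ∷ x) zero _ = refl
weight-raise (false ∷ x) (suc j) yⱼ = weight-raise x j yⱼ
weight-raise (true ∷ x) (suc j) yⱼ = cong suc (weight-raise x j yⱼ)

indexSum-raise : ∀ {m} (y : Config m) j → lookup y j ≡ false → indexSum (y [ j ]≔ true) ≡ indexSum y + toℕ j
indexSum-raise (false ∷ x) zero _ = sym (+-identityʳ _)
indexSum-raise (b ∷ x) (suc j) yⱼ = begin
  weight (x [ j ]≔ true) + indexSum (x [ j ]≔ true) ≡⟨ cong₂ _+_ (weight-raise x j yⱼ) (indexSum-raise x j yⱼ) ⟩
  suc (weight x) + (indexSum x + toℕ j)              ≡⟨ shift (weight x) (indexSum x) (toℕ j) ⟩
  weight x + indexSum x + suc (toℕ j)                ∎
  where
  open ≡-Reasoning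
  shift : ∀ a b c → suc a + (b + c) ≡ a + b + suc c
  shift = solve-∀

count-weight : ∀ n k → cubeSum n (λ x → 𝟙 (weight x ≟ℕ k)) ≡ n C k
count-weight zero zero = refl
count-weight zero (suc k) = refl
count-weight (suc n) zero = cong₂ _+_ (count-weight n zero) (cubeSum-const n 0)
count-weight (suc n) (suc k) =
  trans (cong₂ _+_ (count-weight n (suc k)) (count-weight n k))
        (trans (+-comm (n C suc k) (n C k)) (nCk+nC[k+1]≡[n+1]C[k+1] n k))

%-absorbˡ : ∀ {n} .{{_ : NonZero n}} t j → (t % n + j) % n ≡ (t + j) % n
%-absorbˡ {n} t j = begin
  (t % n + j) % n              ≡⟨ %-distribˡ-+ (t % n) j n ⟩
  (t % n % n + j % n) % n      ≡⟨ cong (λ z → (z + j % n) % n) (m%n%n≡m%n t n) ⟩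
  (t % n + j % n) % n          ≡⟨ sym (%-distribˡ-+ t j n) ⟩
  (t + j) % n                  ∎
  where open ≡-Reasoning

+-cancel-% : ∀ {n} .{{_ : NonZero n}} t {i j} → i < n → j < n → (t + i) % n ≡ (t + j) % n → i ≡ j
+-cancel-% {n} t {i} {j} i<n j<n eq = begin
  i                   ≡⟨ sym (m<n⇒m%n≡m i<n) ⟩
  i % n               ≡⟨ sym ([m+kn]%n≡m%n i q′ n) ⟩
  (i + q′ * n) % n    ≡⟨ cong (_% n) balanced ⟩
  (j + q * n) % n     ≡⟨ [m+kn]%n≡m%n j q n ⟩
  j % n               ≡⟨ m<n⇒m%n≡m j<n ⟩
  j                   ∎
  where
  open ≡-Reasoning
  q = (t + i) / n
  q′ = (t + j) / n
  -- Both t + (i + q′n) and t + (j + qn) equal r + qn + q′n for the common residue r.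
  balanced : i + q′ * n ≡ j + q * n
  balanced = +-cancelˡ-≡ t _ _ (begin
    t + (i + q′ * n)                  ≡⟨ sym (+-assoc t i _) ⟩
    (t + i) + q′ * n                  ≡⟨ cong (_+ q′ * n) (m≡m%n+[m/n]*n (t + i) n) ⟩
    ((t + i) % n + q * n) + q′ * n    ≡⟨ cong (λ r → (r + q * n) + q′ * n) eq ⟩
    ((t + j) % n + q * n) + q′ * n    ≡⟨ xy∙z≈xz∙y ((t + j) % n) (q * n) (q′ * n) ⟩
    ((t + j) % n + q′ * n) + q * n    ≡⟨ cong (_+ q * n) (sym (m≡m%n+[m/n]*n (t + j) n)) ⟩
    (t + j) + q * n                   ≡⟨ +-assoc t j _ ⟩
    t + (j + q * n)                   ∎)

module Construction (n : ℕ) .{{_ : NonZero n}} (k a : ℕ) where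

  InTarget : Config n → Set
  InTarget x = weight x ≡ k × indexSum x % n ≡ a

  -- f_i(x) is decided by Rule i y for y = x[i := 0]: y has more than k ones, or
  -- switching on i puts y into A, or moving some one of y to position i puts y into A.
  Rule : Fin n → Config n → Set
  Rule i y = (suc k ≤ weight y)
           ⊎ (suc (weight y) ≡ k × (indexSum y + toℕ i) % n ≡ a)
           ⊎ (weight y ≡ k × ∃ λ j → lookup y j ≡ true × (indexSum y + toℕ i) % n ≡ (a + toℕ j) % n)

  rule? : ∀ i y → Dec (Rule i y)
  rule? i y = (suc k ≤? weight y)
    ⊎-dec ((suc (weight y) ≟ℕ k) ×-dec ((indexSum y + toℕ i) % n ≟ℕ a))
    ⊎-dec ((weight y ≟ℕ k) ×-dec any? (λ j → (lookup y j ≟𝔹 true) ×-dec ((indexSum y + toℕ i) % n ≟ℕ (a + toℕ j) % n)))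

  f : Config n → Config n
  f x = tabulate (λ i → does (rule? i (x [ i ]≔ false)))

  -- f is in F(K_n^+, 2): x and y agreeing off i have x[i := 0] = y[i := 0].
  lookup-f : ∀ x i → lookup (f x) i ≡ does (rule? i (x [ i ]≔ false))
  lookup-f x i = lookup∘tabulate (λ i → does (rule? i (x [ i ]≔ false))) i

  f-indep : IndepOfSelf n f
  f-indep i x y agree = begin
    lookup (f x) i                   ≡⟨ lookup-f x i ⟩
    does (rule? i (x [ i ]≔ false))  ≡⟨ cong (does ∘ rule? i) (update-agree x y i false agree) ⟩
    does (rule? i (y [ i ]≔ false))  ≡⟨ sym (lookup-f y i) ⟩
    lookup (f y) i                   ∎
    where open ≡-Reasoning

  rule-mono : ∀ i y j → lookup y j ≡ false → Rule i y → Rule i (y [ j ]≔ true)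
  rule-mono i y j yⱼ rule rewrite weight-raise y j yⱼ | indexSum-raise y j yⱼ with rule
  ... | inj₁ k<|y| = inj₁ (m≤n⇒m≤1+n k<|y|)
  ... | inj₂ (inj₁ (|y|+1≡k , residue)) = inj₂ (inj₂ (|y|+1≡k , j , lookup∘update j y true , moved))
    where
    moved : (indexSum y + toℕ j + toℕ i) % n ≡ (a + toℕ j) % n
    moved = begin
      (indexSum y + toℕ j + toℕ i) % n    ≡⟨ cong (_% n) (xy∙z≈xz∙y (indexSum y) (toℕ j) (toℕ i)) ⟩
      (indexSum y + toℕ i + toℕ j) % n    ≡⟨ sym (%-absorbˡ (indexSum y + toℕ i) (toℕ j)) ⟩
      ((indexSum y + toℕ i) % n + toℕ j) % n ≡⟨ cong (λ r → (r + toℕ j) % n) residue ⟩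
      (a + toℕ j) % n                     ∎
      where open ≡-Reasoning
  ... | inj₂ (inj₂ (|y|≡k , _)) = inj₁ (≤-reflexive (cong suc (sym |y|≡k)))

  -- Monotonicity of f_i in x_j (j ≠ i) is rule-mono applied to x[i := 0][j := 0].
  f-mono : MonotoneInOthers n f
  f-mono i j j≢i x = subst₂ _≤𝔹_ (sym (lookup-f (x [ j ]≔ false) i)) (sym (lookup-f (x [ j ]≔ true) i))
    (subst₂ (λ u v → does (rule? i u) ≤𝔹 does (rule? i v)) (sym (swap false)) raised
      (does-mono (rule? i y) (rule? i (y [ j ]≔ true)) (rule-mono i y j (lookup∘update j z false))))
    where
    z = x [ i ]≔ false
    y = z [ j ]≔ false
    swap : ∀ b → (x [ j ]≔ b) [ i ]≔ false ≡ z [ j ]≔ b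
    swap b = []≔-commutes x j i j≢i
    raised : y [ j ]≔ true ≡ (x [ j ]≔ true) [ i ]≔ false
    raised = trans ([]≔-idempotent z j) (sym (swap true))

  -- A point of A, with coordinate i off, would reach A again by moving some one to i;
  -- cancellation modulo n forces that one to sit at i itself.
  target-rejects : ∀ x i → InTarget x → lookup x i ≡ false → ¬ Rule i x
  target-rejects x i (|x|≡k , _) _ (inj₁ k<|x|) = <-irrefl (sym |x|≡k) k<|x|
  target-rejects x i (|x|≡k , _) _ (inj₂ (inj₁ (|x|+1≡k , _))) = <-irrefl (trans |x|≡k (sym |x|+1≡k)) ≤-refl
  target-rejects x i (_ , residue) xᵢ (inj₂ (inj₂ (_ , j , xⱼ , moved))) = not-¬ refl (trans (sym xᵢ) (subst (λ t → lookup x t ≡ true) (sym i≡j) xⱼ))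
    where
    same-residue : (indexSum x + toℕ i) % n ≡ (indexSum x + toℕ j) % n
    same-residue = trans moved (trans (cong (λ r → (r + toℕ j) % n) (sym residue)) (%-absorbˡ (indexSum x) (toℕ j)))
    i≡j : i ≡ j
    i≡j = toℕ-injective (+-cancel-% (indexSum x) (toℕ<n i) (toℕ<n j) same-residue)

  -- Every point of A is fixed: coordinates that are on satisfy the second clause of the
  -- rule, coordinates that are off violate every clause.
  target-fixed : ∀ x → InTarget x → f x ≡ x
  target-fixed x inA@(|x|≡k , residue) = trans (tabulate-cong decide) (tabulate∘lookup x)
    where
    decide : ∀ i → does (rule? i (x [ i ]≔ false)) ≡ lookup x i
    decide i with lookup x i in xᵢ
    ... | true = does-yes (rule? i y) (inj₂ (inj₁ (trans (sym |x|≡|y|+1) |x|≡k , trans (cong (_% n) (sym σx)) residue)))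
      where
      y = x [ i ]≔ false
      x≡y+i : y [ i ]≔ true ≡ x
      x≡y+i = trans ([]≔-idempotent x i) (trans (cong (x [ i ]≔_) (sym xᵢ)) ([]≔-lookup x i))
      |x|≡|y|+1 : weight x ≡ suc (weight y)
      |x|≡|y|+1 = trans (cong weight (sym x≡y+i)) (weight-raise y i (lookup∘update i x false))
      σx : indexSum x ≡ indexSum y + toℕ i
      σx = trans (cong indexSum (sym x≡y+i)) (indexSum-raise y i (lookup∘update i x false))
    ... | false = trans (cong (does ∘ rule? i) x-off) (does-no (rule? i x) (target-rejects x i inA xᵢ))
      where
      x-off : x [ i ]≔ false ≡ x
      x-off = trans (cong (x [ i ]≔_) (sym xᵢ)) ([]≔-lookup x i)

  targetSize : ℕ
  targetSize = cubeSum n (λ x → 𝟙 (weight x ≟ℕ k) * 𝟙 (indexSum x % n ≟ℕ a))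

  targetSize≤numFix : targetSize ≤ numFix n f
  targetSize≤numFix = subst (targetSize ≤_) (sym (numFix≡cubeSum n f))
    (cubeSum-mono n (λ x → 𝟙*𝟙≤𝟙 (weight x ≟ℕ k) (indexSum x % n ≟ℕ a) (≡-dec _≟𝔹_ (f x) x) (λ w r → target-fixed x (w , r))))

sum-indicator : ∀ n m → m < n → sum {n} (λ a → 𝟙 (m ≟ℕ toℕ a)) ≡ 1
sum-indicator (suc n) zero _ = cong suc (sum-replicate-zero n)
sum-indicator (suc n) (suc m) (s≤s m<n) = sum-indicator n m m<n

residue-partition : ∀ n .{{_ : NonZero n}} k → sum {n} (λ a → Construction.targetSize n k (toℕ a)) ≡ n C k
residue-partition n k = begin
  sum (λ a → cubeSum n (λ x → W x * R x a))    ≡⟨ sym (cubeSum-sum n (λ a x → W x * R x a)) ⟩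
  cubeSum n (λ x → sum (λ a → W x * R x a))    ≡⟨ cubeSum-cong n one-residue ⟩
  cubeSum n W                                  ≡⟨ count-weight n k ⟩
  n C k                                        ∎
  where
  open ≡-Reasoning
  W : Config n → ℕ
  W x = 𝟙 (weight x ≟ℕ k)
  R : Config n → Fin n → ℕ
  R x a = 𝟙 (indexSum x % n ≟ℕ toℕ a)
  one-residue : ∀ x → sum (λ a → W x * R x a) ≡ W x
  one-residue x = begin
    sum (λ a → W x * R x a)  ≡⟨ sym (*-distribˡ-sum (W x) (R x)) ⟩
    W x * sum (R x)          ≡⟨ cong (W x *_) (sum-indicator n (indexSum x % n) (m%n<n (indexSum x) n)) ⟩
    W x * 1                  ≡⟨ *-identityʳ (W x) ⟩
    W x                      ∎

lower-bound : ∀ n′ → Σ (Config (suc n′) → Config (suc n′)) (λ f → InF (suc n′) f × 4 ^ suc n′ ≤ 8 * suc n′ ^ 3 * numFix (suc n′) f ^ 2)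
lower-bound n′ with binomial-bound n′
... | k , central with pigeonhole n′ (λ a → Construction.targetSize (suc n′) k (toℕ a))
... | a , crowded = A.f , (A.f-indep , A.f-mono) , (begin
  4 ^ n                                      ≤⟨ central ⟩
  8 * n * (B * B)                            ≤⟨ *-monoʳ-≤ (8 * n) (*-mono-≤ B≤ B≤) ⟩
  8 * n * ((n * A.targetSize) * (n * A.targetSize)) ≡⟨ cube n A.targetSize ⟩
  8 * n ^ 3 * A.targetSize ^ 2               ≤⟨ *-monoʳ-≤ (8 * n ^ 3) (^-monoˡ-≤ 2 A.targetSize≤numFix) ⟩
  8 * n ^ 3 * numFix n A.f ^ 2               ∎)
  where
  open ≤-Reasoning
  n = suc n′
  module A = Construction n k (toℕ a)
  B = n C k
  B≤ : B ≤ n * A.targetSize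
  B≤ = subst (_≤ n * A.targetSize) (residue-partition n k) crowded
  cube : ∀ m x → 8 * m * ((m * x) * (m * x)) ≡ 8 * (m * (m * (m * 1))) * (x * (x * 1))
  cube = solve-∀

proposition5 : (n : ℕ) → 1 ≤ n →
    (Σ (Config n → Config n) (λ f → InF n f × 4 ^ n ≤ 8 * n ^ 3 * numFix n f ^ 2))
    × (∀ (f : Config n → Config n) → InF n f → numFix n f * (n + 2) ≤ 2 ^ (n + 1))
proposition5 zero ()
proposition5 (suc n′) _ = lower-bound n′ , λ f (indep , mono) → UpperBound.upper-bound f indep mono
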